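{- Let $X$ be a finite pure $d$-dimensional simplicial complex, $0\le i<d$, and $0<\eta<1$. Then for every $i$-cochain $W\subseteq X(i)$ and every $0\le j\le i$, $$\Pr\big[P_{i+1}\in\Gamma(W)\wedge P_{j-1}\notin S^{j-1}(W)\big]\ge\eta^{2^{i-j}-1}\,\Pr\big[P_j\in S^j(W)\wedge P_{j-1}\notin S^{j-1}(W)\big].$$
   Context: A simplicial complex $X$ on a finite vertex set is a family of subsets (faces) closed under taking subsets; it contains $\emptyset$. A face $\sigma$ has dimension $|\sigma|-1$; $X(i)$ is the set of $i$-faces, $X(-1)=\{\emptyset\}$. $X$ is $d$-dimensional if its maximal face dimension is $d$, pure if every face lies in a $d$-face. $\deg(\sigma)$ is the number of $d$-faces containing $\sigma$. Random faces: let $P_d$ be a uniformly random $d$-face, and for $k=d-1,\dots,-1$ let $P_k$ be obtained from $P_{k+1}$ by deleting a uniformly random vertex (independently). For $U\subseteq X(k)$, $\|U\|=\Pr[P_k\in U]=\sum_{\sigma\in U}\deg(\sigma)/\sum_{\tau\in X(k)}\deg(\tau)$. The link of $\sigma$ is $X_\sigma=\{\tau\setminus\sigma:\tau\in X,\tau\supseteq\sigma\}$ and $\|\cdot\|_\sigma$ is the analogous norm in $X_\sigma$. For $U\subseteq X(k)$ and a face $\sigma$ of dimension $<k$, $U_\sigma=\{\tau\in X_\sigma:\tau\sqcup\sigma\in U\}$, so $\|U_\sigma\|_\sigma=\Pr[P_k\in U\mid P_{\dim\sigma}=\sigma]$. Fat faces (fatness constant $\eta$): $S^i(W)=W$, and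 for $-1\le j<i$, $S^j(W)=\{\sigma\in X(j):\|S^{j+1}(W)_\sigma\|_\sigma\ge\eta^{2^{i-j-1}}\}$. The container of $W\subseteq X(i)$ is $\Gamma(W)=\{\tau\in X(i+1):\exists\,\sigma\subset\tau,\ \sigma\in W\}$.
   Formalization: The fatness constant η ranges over the rationals with 0 < η < 1. -}

module Defs where

open import Data.Bool using (Bool; true; false; _∧_; _∨_; not; if_then_else_; T)
open import Data.Nat as ℕ using (ℕ; zero; suc; _∸_; _≤ᵇ_; _≡ᵇ_)
open import Data.Fin using (Fin; toℕ)
open import Data.Vec using (Vec; []; _∷_)
open import Data.List as List using (List; []; _∷_; _++_; concatMap; map; filter; length)
open import Data.Bool.ListAction using (any)
open import Data.Product using (Σ; _×_; _,_; proj₁; proj₂)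
open import Data.Unit using (⊤; tt)
open import Data.Integer using (+_)
open import Data.Rational as ℚ using (ℚ; 0ℚ; 1ℚ; _*_; _/_)
open import Data.Fin.Subset using (Subset; ∣_∣)
open import Relation.Binary.PropositionalEquality using (_≡_)

-- Faces: subsets of the vertex set Fin n, encoded as Subset n = Vec Bool n.
-- A face of dimension k has size k+1; throughout we index levels by SIZE
-- s = dim + 1 (so dimension -1 corresponds to size 0).

allSubsets : (n : ℕ) → List (Subset n)
allSubsets zero    = [] ∷ []
allSubsets (suc n) = map (true ∷_) (allSubsets n) ++ map (false ∷_) (allSubsets n)

_⊆ᵇ_ : ∀ {n} → Subset n → Subset n → Bool
[]          ⊆ᵇ []          = true
(true ∷ σ)  ⊆ᵇ (b ∷ τ)     = b ∧ (σ ⊆ᵇ τ)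
(false ∷ σ) ⊆ᵇ (_ ∷ τ)     = σ ⊆ᵇ τ

IsSimplicialComplex : ∀ {n} → (Subset n → Bool) → Set
IsSimplicialComplex {n} X =
  (σ τ : Subset n) → T (σ ⊆ᵇ τ) → T (X τ) → T (X σ)

IsPureOfDim : ∀ {n} → (Subset n → Bool) → ℕ → Set
IsPureOfDim {n} X d =
  Σ (Subset n) (λ F → T (X F) × ∣ F ∣ ≡ suc d)
  × ((σ : Subset n) → T (X σ) → ∣ σ ∣ ℕ.≤ suc d)
  × ((σ : Subset n) → T (X σ) → Σ (Subset n) (λ F → T (X F) × ∣ F ∣ ≡ suc d × T (σ ⊆ᵇ F)))

facesOfSize : ∀ {n} → (Subset n → Bool) → ℕ → List (Subset n)
facesOfSize {n} X s = List.filter (λ σ → Data.Bool._≟_ (X σ ∧ (∣ σ ∣ ≡ᵇ s)) true) (allSubsets n)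
  where import Data.Bool

-- An outcome is a d-face F together with the sequence of choices: from a face
-- of size m one deletes its c-th vertex (in increasing vertex order), c : Fin m.

Choices : ℕ → Set
Choices zero    = ⊤
Choices (suc m) = Fin (suc m) × Choices m

allChoices : (m : ℕ) → List (Choices m)
allChoices zero    = tt ∷ []
allChoices (suc m) = concatMap (λ c → map (c ,_) (allChoices m)) (List.allFin (suc m))

deleteNth : ∀ {n} → ℕ → Subset n → Subset n
deleteNth c       []          = []
deleteNth c       (false ∷ σ) = false ∷ deleteNth c σ
deleteNth zero    (true ∷ σ)  = false ∷ σ
deleteNth (suc c) (true ∷ σ)  = true ∷ deleteNth c σ

down : ∀ {n} (m : ℕ) → Subset n → Choices m → ℕ → Subset n
down zero    σ tt       s = σ
down (suc m) σ (c , cs) s =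
  if suc m ≤ᵇ s then σ else down m (deleteNth (toℕ c) σ) cs s

Outcome : ℕ → ℕ → Set
Outcome n d = Subset n × Choices (suc d)

outcomes : ∀ {n} → (Subset n → Bool) → (d : ℕ) → List (Outcome n d)
outcomes X d = concatMap (λ F → map (F ,_) (allChoices (suc d))) (facesOfSize X (suc d))

-- P_k of an outcome, indexed by SIZE s = k+1
Pat : ∀ {n d} → Outcome n d → ℕ → Subset n
Pat {d = d} (F , cs) s = down (suc d) F cs s

count : ∀ {A : Set} → (A → Bool) → List A → ℕ
count p []       = 0
count p (x ∷ xs) = if p x then suc (count p xs) else count p xs

ratio : ℕ → ℕ → ℚ
ratio k zero    = 0ℚ
ratio k (suc t) = (+ k) / suc t

Pr : ∀ {n} → (Subset n → Bool) → (d : ℕ) → (Outcome n d → Bool) → ℚ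
Pr X d E = ratio (count E (outcomes X d)) (length (outcomes X d))

-- ‖U_σ‖_σ = Pr[P_k ∈ U | P_{dim σ} = σ], for U a set of faces of size sU
-- and σ a face (of smaller size)
_==ˢ_ : ∀ {n} → Subset n → Subset n → Bool
[] ==ˢ [] = true
(a ∷ σ) ==ˢ (b ∷ τ) = (if a then b else not b) ∧ (σ ==ˢ τ)

linkNorm : ∀ {n} → (Subset n → Bool) → (d : ℕ) → (U : Subset n → Bool) → (sU : ℕ) → Subset n → ℚ
linkNorm X d U sU σ =
  ratio (count (λ o → (Pat o ∣ σ ∣ ==ˢ σ) ∧ U (Pat o sU)) (outcomes X d))
        (count (λ o → Pat o ∣ σ ∣ ==ˢ σ) (outcomes X d))

pow : ℚ → ℕ → ℚ
pow q zero    = 1ℚ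
pow q (suc k) = q * pow q k

-- Fat faces.  W ⊆ X(i) (faces of size i+1).  S^{i-t}(W) is fatSet t:
-- S^i(W) = W, and S^{j}(W) = { σ ∈ X(j) : ‖S^{j+1}(W)_σ‖_σ ≥ η^{2^{i-j-1}} }.
fatSet : ∀ {n} → (Subset n → Bool) → (d i : ℕ) → ℚ → (Subset n → Bool) → ℕ → Subset n → Bool
fatSet X d i η W zero    σ = W σ
fatSet X d i η W (suc t) σ =
  X σ ∧ (∣ σ ∣ ≡ᵇ (suc i ∸ suc t)) ∧
  (pow η (2 ℕ.^ t) ℚ.≤ᵇ linkNorm X d (fatSet X d i η W t) (suc i ∸ t) σ)

S : ∀ {n} → (Subset n → Bool) → (d i : ℕ) → ℚ → (Subset n → Bool) → (s : ℕ) → Subset n → Bool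
S X d i η W s = fatSet X d i η W (suc i ∸ s)

Γ : ∀ {n} → (Subset n → Bool) → (i : ℕ) → (Subset n → Bool) → Subset n → Bool
Γ {n} X i W τ =
  X τ ∧ (∣ τ ∣ ≡ᵇ suc (suc i)) ∧
  any (λ σ → W σ ∧ (σ ⊆ᵇ τ) ∧ not (σ ==ˢ τ)) (allSubsets n)

-- The random faces P_d ⊃ P_(d-1) ⊃ ⋯ form a Markov chain: given P_k = σ, the faces above σ and
-- the face below it are independent. Hence a lower bound Pr[A | P_k = σ] ≥ q holding for every
-- σ ∈ F survives extra conditioning on any event B about P_(k-1):
--   Pr[P_k ∈ F ∧ A ∧ B] ≥ q · Pr[P_k ∈ F ∧ B].
-- Applied along the recursive definition of fat faces, this gives Pr[P_i ∈ W | P_j = σ] ≥ η^(2^(i-j)-1)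
-- for σ ∈ S^j(W), the exponents 1 + 2 + ⋯ + 2^(i-j-1) adding up. One more application, with
-- B = "P_(j-1) ∉ S^(j-1)(W)", gives the claim, because P_i ∈ W forces P_(i+1) ∈ Γ(W).

module Submission where

open import Defs
open import Data.Bool using (Bool; true; false; T; not; _∧_; if_then_else_)
open import Data.Bool.Properties using (∧-assoc; ∧-comm; ∧-identityʳ; ∧-zeroʳ; T-∧; T-≡)
open import Data.Empty using (⊥-elim)
open import Data.Fin using (toℕ)
open import Data.Fin.Properties using (toℕ<n)
open import Data.Fin.Subset using (Subset; ∣_∣)
import Data.Integer as ℤ
import Data.Integer.Properties as ℤP
open import Data.List as List using (List; []; _∷_; _++_; map; concatMap; length)
open import Data.List.Membership.Propositional using (_∈_; lose)
open import Data.List.Membership.Propositional.Properties using (∈-map⁺; ∈-++⁺ˡ; ∈-++⁺ʳ)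
open import Data.List.Relation.Unary.All as All using (All; []; _∷_)
open import Data.List.Relation.Unary.All.Properties using (all-filter; concat⁺; map⁺)
open import Data.List.Relation.Unary.Any using (here)
open import Data.List.Relation.Unary.Any.Properties using (any⁺)
open import Data.Nat as ℕ using (ℕ; zero; suc; _+_; _∸_; _^_; _≤_; _<_; z≤n; s≤s; _≤ᵇ_; _≡ᵇ_)
import Data.Nat.Properties as ℕP
open import Algebra.Properties.CommutativeSemigroup ℕP.+-commutativeSemigroup using (interchange)
open import Data.Product using (Σ; _×_; _,_; proj₁; proj₂)
open import Data.Rational as ℚ using (ℚ; 0ℚ; 1ℚ; _*_; toℚᵘ; NonNegative; Positive)
  renaming (_<_ to _<ℚ_; _≤_ to _≤ℚ_)
open import Data.Rational.Properties
open import Data.Rational.Unnormalised as ℚᵘ using (mkℚᵘ; *≡*)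
import Data.Rational.Unnormalised.Properties as ℚᵘP
open import Data.Sum using (inj₁; inj₂)
open import Data.Unit using (tt)
open import Data.Vec using ([]; _∷_)
open import Function using (_∘_)
open import Function.Bundles using (Equivalence)
open import Relation.Binary.PropositionalEquality
open import Relation.Nullary.Reflects using (ofʸ)
open Equivalence using (to; from)

∑ : {A : Set} → (A → ℕ) → List A → ℕ
∑ f []       = 0
∑ f (x ∷ xs) = f x + ∑ f xs

∑-cong : {A : Set} {f g : A → ℕ} (xs : List A) → (∀ x → f x ≡ g x) → ∑ f xs ≡ ∑ g xs
∑-cong []       f≗g = refl
∑-cong (x ∷ xs) f≗g = cong₂ _+_ (f≗g x) (∑-cong xs f≗g)

∑-zero : {A : Set} (xs : List A) → ∑ (λ _ → 0) xs ≡ 0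
∑-zero []       = refl
∑-zero (x ∷ xs) = ∑-zero xs

∑-+ : {A : Set} (f g : A → ℕ) (xs : List A) → ∑ (λ x → f x + g x) xs ≡ ∑ f xs + ∑ g xs
∑-+ f g []       = refl
∑-+ f g (x ∷ xs) =
  trans (cong (f x + g x +_) (∑-+ f g xs)) (interchange (f x) (g x) (∑ f xs) (∑ g xs))

∑-*ʳ : {A : Set} (f : A → ℕ) (k : ℕ) (xs : List A) → ∑ (λ x → f x ℕ.* k) xs ≡ ∑ f xs ℕ.* k
∑-*ʳ f k []       = refl
∑-*ʳ f k (x ∷ xs) =
  trans (cong (f x ℕ.* k +_) (∑-*ʳ f k xs)) (sym (ℕP.*-distribʳ-+ k (f x) (∑ f xs)))

indicator : Bool → ℕ
indicator true  = 1
indicator false = 0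

count-∷ : {A : Set} (p : A → Bool) (x : A) (xs : List A) →
          count p (x ∷ xs) ≡ indicator (p x) + count p xs
count-∷ p x xs with p x
... | true  = refl
... | false = refl

count-as-∑ : {A : Set} (p : A → Bool) (xs : List A) → count p xs ≡ ∑ (λ x → indicator (p x)) xs
count-as-∑ p []       = refl
count-as-∑ p (x ∷ xs) = trans (count-∷ p x xs) (cong (indicator (p x) +_) (count-as-∑ p xs))

count-cong : {A : Set} {p q : A → Bool} (xs : List A) → (∀ x → p x ≡ q x) → count p xs ≡ count q xs
count-cong         []       p≗q = refl
count-cong {q = q} (x ∷ xs) p≗q rewrite p≗q x with q x
... | true  = cong suc (count-cong xs p≗q)
... | false = count-cong xs p≗q

count-++ : {A : Set} (p : A → Bool) (xs ys : List A) → count p (xs ++ ys) ≡ count p xs + count p ys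
count-++ p []       ys = refl
count-++ p (x ∷ xs) ys with p x
... | true  = cong suc (count-++ p xs ys)
... | false = count-++ p xs ys

count-map : {A B : Set} (p : B → Bool) (f : A → B) (xs : List A) →
            count p (map f xs) ≡ count (λ x → p (f x)) xs
count-map p f []       = refl
count-map p f (x ∷ xs) with p (f x)
... | true  = cong suc (count-map p f xs)
... | false = count-map p f xs

count-concatMap : {A B : Set} (p : B → Bool) (f : A → List B) (xs : List A) →
                  count p (concatMap f xs) ≡ ∑ (λ x → count p (f x)) xs
count-concatMap p f []       = refl
count-concatMap p f (x ∷ xs) =
  trans (count-++ p (f x) (concatMap f xs)) (cong (count p (f x) +_) (count-concatMap p f xs))

count-≡0 : {A : Set} (p : A → Bool) (xs : List A) → (∀ x → p x ≡ false) → count p xs ≡ 0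
count-≡0 p []       p≗false = refl
count-≡0 p (x ∷ xs) p≗false rewrite p≗false x = count-≡0 p xs p≗false

count-mono : {A : Set} (p q : A → Bool) (xs : List A) → All (λ x → T (p x) → T (q x)) xs →
             count p xs ≤ count q xs
count-mono p q []       []           = z≤n
count-mono p q (x ∷ xs) (p⇒q ∷ p⇒qs) with p x | q x | p⇒q
... | true  | true  | _   = s≤s (count-mono p q xs p⇒qs)
... | true  | false | p⇒q = ⊥-elim (p⇒q _)
... | false | true  | _   = ℕP.m≤n⇒m≤1+n (count-mono p q xs p⇒qs)
... | false | false | _   = count-mono p q xs p⇒qs

==ˢ-sound : ∀ {n} {σ τ : Subset n} → T (σ ==ˢ τ) → σ ≡ τ
==ˢ-sound {σ = []}        {[]}        _ = refl
==ˢ-sound {σ = true ∷ σ}  {true ∷ τ}  h = cong (true ∷_) (==ˢ-sound h)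
==ˢ-sound {σ = false ∷ σ} {false ∷ τ} h = cong (false ∷_) (==ˢ-sound h)
==ˢ-sound {σ = true ∷ σ}  {false ∷ τ} ()
==ˢ-sound {σ = false ∷ σ} {true ∷ τ}  ()

==ˢ-∧-subst : ∀ {n} (σ τ : Subset n) (h : Subset n → Bool) → (σ ==ˢ τ) ∧ h σ ≡ (σ ==ˢ τ) ∧ h τ
==ˢ-∧-subst σ τ h with σ ==ˢ τ in eq
... | false = refl
... | true rewrite ==ˢ-sound {σ = σ} {τ} (subst T (sym eq) _) = refl

⊆ᵇ-refl : ∀ {n} (σ : Subset n) → T (σ ⊆ᵇ σ)
⊆ᵇ-refl []          = tt
⊆ᵇ-refl (true ∷ σ)  = ⊆ᵇ-refl σ
⊆ᵇ-refl (false ∷ σ) = ⊆ᵇ-refl σ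

⊆ᵇ-trans : ∀ {n} (ρ σ τ : Subset n) → T (ρ ⊆ᵇ σ) → T (σ ⊆ᵇ τ) → T (ρ ⊆ᵇ τ)
⊆ᵇ-trans []          []          []          _   _   = tt
⊆ᵇ-trans (true ∷ ρ)  (true ∷ σ)  (true ∷ τ)  ρ⊆σ σ⊆τ = ⊆ᵇ-trans ρ σ τ ρ⊆σ σ⊆τ
⊆ᵇ-trans (false ∷ ρ) (true ∷ σ)  (true ∷ τ)  ρ⊆σ σ⊆τ = ⊆ᵇ-trans ρ σ τ ρ⊆σ σ⊆τ
⊆ᵇ-trans (false ∷ ρ) (false ∷ σ) (b ∷ τ)     ρ⊆σ σ⊆τ = ⊆ᵇ-trans ρ σ τ ρ⊆σ σ⊆τ

∈-allSubsets : ∀ {n} (σ : Subset n) → σ ∈ allSubsets n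
∈-allSubsets []          = here refl
∈-allSubsets (true ∷ σ)  = ∈-++⁺ˡ (∈-map⁺ (true ∷_) (∈-allSubsets σ))
∈-allSubsets (false ∷ σ) = ∈-++⁺ʳ (map (true ∷_) (allSubsets _)) (∈-map⁺ (false ∷_) (∈-allSubsets σ))

count-==ˢ-allSubsets : ∀ {n} (σ : Subset n) → count (σ ==ˢ_) (allSubsets n) ≡ 1
count-==ˢ-allSubsets {zero}  []      = refl
count-==ˢ-allSubsets {suc n} (b ∷ σ) =
  trans (count-++ ((b ∷ σ) ==ˢ_) (map (true ∷_) Ss) (map (false ∷_) Ss))
        (trans (cong₂ _+_ (count-map _ (true ∷_) Ss) (count-map _ (false ∷_) Ss)) (split b))
  where
  Ss = allSubsets n
  split : ∀ b → count (λ τ → (b ∷ σ) ==ˢ (true ∷ τ)) Ss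
              + count (λ τ → (b ∷ σ) ==ˢ (false ∷ τ)) Ss ≡ 1
  split true  = cong₂ _+_ (count-==ˢ-allSubsets σ) (count-≡0 _ Ss (λ _ → refl))
  split false = cong₂ _+_ (count-≡0 _ Ss (λ _ → refl)) (count-==ˢ-allSubsets σ)

∑-indicator-==ˢ : ∀ {n} (σ : Subset n) (b : Bool) →
                  ∑ (λ τ → indicator ((σ ==ˢ τ) ∧ b)) (allSubsets n) ≡ indicator b
∑-indicator-==ˢ {n} σ b = trans (sym (count-as-∑ (λ τ → (σ ==ˢ τ) ∧ b) (allSubsets n))) (by b)
  where
  by : ∀ b → count (λ τ → (σ ==ˢ τ) ∧ b) (allSubsets n) ≡ indicator b
  by true  = trans (count-cong (allSubsets n) (λ τ → ∧-identityʳ (σ ==ˢ τ))) (count-==ˢ-allSubsets σ)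
  by false = count-≡0 _ (allSubsets n) (λ τ → ∧-zeroʳ (σ ==ˢ τ))

count-partition : ∀ {n} {A : Set} (k : A → Subset n) (E : A → Bool) (xs : List A) →
                  count E xs ≡ ∑ (λ τ → count (λ x → (k x ==ˢ τ) ∧ E x) xs) (allSubsets n)
count-partition {n} k E []       = sym (∑-zero (allSubsets n))
count-partition {n} k E (x ∷ xs) = begin
  count E (x ∷ xs)
    ≡⟨ count-∷ E x xs ⟩
  indicator (E x) + count E xs
    ≡⟨ cong₂ _+_ (sym (∑-indicator-==ˢ (k x) (E x))) (count-partition k E xs) ⟩
  ∑ (λ τ → indicator (E′ τ x)) Ss + ∑ (λ τ → count (E′ τ) xs) Ss
    ≡⟨ sym (∑-+ _ _ Ss) ⟩
  ∑ (λ τ → indicator (E′ τ x) + count (E′ τ) xs) Ss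
    ≡⟨ sym (∑-cong Ss (λ τ → count-∷ (E′ τ) x xs)) ⟩
  ∑ (λ τ → count (E′ τ) (x ∷ xs)) Ss ∎
  where
  open ≡-Reasoning
  Ss = allSubsets n
  E′ = λ τ x → (k x ==ˢ τ) ∧ E x

-- Opaque, so that comparing two such terms never unfolds the gcd normalisation of ℚ.
opaque
  ⟦_⟧ : ℕ → ℚ
  ⟦ k ⟧ = ratio k 1

  toℚᵘ-⟦⟧ : ∀ k → toℚᵘ ⟦ k ⟧ ℚᵘ.≃ mkℚᵘ (ℤ.+ k) 0
  toℚᵘ-⟦⟧ k = toℚᵘ-fromℚᵘ (mkℚᵘ (ℤ.+ k) 0)

  ⟦⟧-nonNeg : ∀ k → NonNegative ⟦ k ⟧
  ⟦⟧-nonNeg k = normalize-nonNeg k 1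

  ⟦⟧-pos : ∀ k → Positive ⟦ suc k ⟧
  ⟦⟧-pos k = normalize-pos (suc k) 1

  ⟦0⟧ : ⟦ 0 ⟧ ≡ 0ℚ
  ⟦0⟧ = refl

⟦⟧-+ : ∀ a b → ⟦ a + b ⟧ ≡ ⟦ a ⟧ ℚ.+ ⟦ b ⟧
⟦⟧-+ a b = toℚᵘ-injective (begin
  toℚᵘ ⟦ a + b ⟧                      ≈⟨ toℚᵘ-⟦⟧ (a + b) ⟩
  mkℚᵘ (ℤ.+ (a + b)) 0                ≈⟨ *≡* numerators ⟩
  mkℚᵘ (ℤ.+ a) 0 ℚᵘ.+ mkℚᵘ (ℤ.+ b) 0  ≈⟨ ℚᵘP.+-cong (toℚᵘ-⟦⟧ a) (toℚᵘ-⟦⟧ b) ⟨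
  toℚᵘ ⟦ a ⟧ ℚᵘ.+ toℚᵘ ⟦ b ⟧          ≈⟨ toℚᵘ-homo-+ ⟦ a ⟧ ⟦ b ⟧ ⟨
  toℚᵘ (⟦ a ⟧ ℚ.+ ⟦ b ⟧)              ∎)
  where
  open ℚᵘP.≃-Reasoning
  numerators = trans (ℤP.*-identityʳ _) (sym (trans (ℤP.*-identityʳ _)
    (trans (cong₂ ℤ._+_ (ℤP.*-identityʳ (ℤ.+ a)) (ℤP.*-identityʳ (ℤ.+ b))) (sym (ℤP.pos-+ a b)))))

⟦⟧-* : ∀ a b → ⟦ a ℕ.* b ⟧ ≡ ⟦ a ⟧ * ⟦ b ⟧
⟦⟧-* a b = toℚᵘ-injective (begin
  toℚᵘ ⟦ a ℕ.* b ⟧                    ≈⟨ toℚᵘ-⟦⟧ (a ℕ.* b) ⟩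
  mkℚᵘ (ℤ.+ (a ℕ.* b)) 0              ≈⟨ *≡* numerators ⟩
  mkℚᵘ (ℤ.+ a) 0 ℚᵘ.* mkℚᵘ (ℤ.+ b) 0  ≈⟨ ℚᵘP.*-cong (toℚᵘ-⟦⟧ a) (toℚᵘ-⟦⟧ b) ⟨
  toℚᵘ ⟦ a ⟧ ℚᵘ.* toℚᵘ ⟦ b ⟧          ≈⟨ toℚᵘ-homo-* ⟦ a ⟧ ⟦ b ⟧ ⟨
  toℚᵘ (⟦ a ⟧ * ⟦ b ⟧)                ∎)
  where
  open ℚᵘP.≃-Reasoning
  numerators = trans (ℤP.*-identityʳ _) (sym (trans (ℤP.*-identityʳ _) (sym (ℤP.pos-* a b))))

ratio-*-denominator : ∀ k t → ratio k (suc t) * ⟦ suc t ⟧ ≡ ⟦ k ⟧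
ratio-*-denominator k t = toℚᵘ-injective (begin
  toℚᵘ (ratio k (suc t) * ⟦ suc t ⟧)          ≈⟨ toℚᵘ-homo-* (ratio k (suc t)) ⟦ suc t ⟧ ⟩
  toℚᵘ (ratio k (suc t)) ℚᵘ.* toℚᵘ ⟦ suc t ⟧  ≈⟨ ℚᵘP.*-cong (toℚᵘ-fromℚᵘ (mkℚᵘ (ℤ.+ k) t)) (toℚᵘ-⟦⟧ (suc t)) ⟩
  mkℚᵘ (ℤ.+ k) t ℚᵘ.* mkℚᵘ (ℤ.+ suc t) 0      ≈⟨ *≡* numerators ⟩
  mkℚᵘ (ℤ.+ k) 0                              ≈⟨ toℚᵘ-⟦⟧ k ⟨
  toℚᵘ ⟦ k ⟧                                  ∎)
  where
  open ℚᵘP.≃-Reasoning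
  numerators = trans (ℤP.*-identityʳ _) (trans (sym (ℤP.pos-* k (suc t)))
    (trans (cong (λ z → ℤ.+ (k ℕ.* suc z)) (sym (ℕP.*-identityʳ t))) (ℤP.pos-* k (suc (t ℕ.* 1)))))

0≤⟦⟧ : ∀ k → 0ℚ ≤ℚ ⟦ k ⟧
0≤⟦⟧ k = nonNegative⁻¹ ⟦ k ⟧ {{⟦⟧-nonNeg k}}

*⟦0⟧≤ : ∀ q k → q * ⟦ 0 ⟧ ≤ℚ ⟦ k ⟧
*⟦0⟧≤ q k = ≤-trans (≤-reflexive (trans (cong (q *_) ⟦0⟧) (*-zeroʳ q))) (0≤⟦⟧ k)

⟦⟧-mono : ∀ {a b} → a ≤ b → ⟦ a ⟧ ≤ℚ ⟦ b ⟧
⟦⟧-mono {a} {b} a≤b = begin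
  ⟦ a ⟧                  ≡⟨ sym (+-identityʳ ⟦ a ⟧) ⟩
  ⟦ a ⟧ ℚ.+ 0ℚ           ≤⟨ +-monoʳ-≤ ⟦ a ⟧ (0≤⟦⟧ (b ∸ a)) ⟩
  ⟦ a ⟧ ℚ.+ ⟦ b ∸ a ⟧    ≡⟨ sym (⟦⟧-+ a (b ∸ a)) ⟩
  ⟦ a + (b ∸ a) ⟧        ≡⟨ cong ⟦_⟧ (ℕP.m+[n∸m]≡n a≤b) ⟩
  ⟦ b ⟧                  ∎
  where open ≤-Reasoning

*-ratio-mono : ∀ q a b N → q * ⟦ a ⟧ ≤ℚ ⟦ b ⟧ → q * ratio a N ≤ℚ ratio b N
*-ratio-mono q a b zero    _     = ≤-reflexive (*-zeroʳ q)
*-ratio-mono q a b (suc t) qa≤b = *-cancelʳ-≤-pos ⟦ suc t ⟧ {{⟦⟧-pos t}} (begin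
  q * ratio a (suc t) * ⟦ suc t ⟧    ≡⟨ *-assoc q _ _ ⟩
  q * (ratio a (suc t) * ⟦ suc t ⟧)  ≡⟨ cong (q *_) (ratio-*-denominator a t) ⟩
  q * ⟦ a ⟧                          ≤⟨ qa≤b ⟩
  ⟦ b ⟧                              ≡⟨ sym (ratio-*-denominator b t) ⟩
  ratio b (suc t) * ⟦ suc t ⟧        ∎)
  where open ≤-Reasoning

≤-ratio⇒*-≤ : ∀ p a c → p ≤ℚ ratio a c → p * ⟦ c ⟧ ≤ℚ ⟦ a ⟧
≤-ratio⇒*-≤ p a zero    _        = *⟦0⟧≤ p a
≤-ratio⇒*-≤ p a (suc t) p≤ratio = begin
  p * ⟦ suc t ⟧                ≤⟨ *-monoʳ-≤-nonNeg ⟦ suc t ⟧ {{⟦⟧-nonNeg (suc t)}} p≤ratio ⟩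
  ratio a (suc t) * ⟦ suc t ⟧  ≡⟨ ratio-*-denominator a t ⟩
  ⟦ a ⟧                        ∎
  where open ≤-Reasoning

*-⟦∑⟧-mono : {A : Set} (q : ℚ) (a b : A → ℕ) → (∀ x → q * ⟦ a x ⟧ ≤ℚ ⟦ b x ⟧) →
             ∀ xs → q * ⟦ ∑ a xs ⟧ ≤ℚ ⟦ ∑ b xs ⟧
*-⟦∑⟧-mono q a b qa≤b []       = *⟦0⟧≤ q 0
*-⟦∑⟧-mono q a b qa≤b (x ∷ xs) = begin
  q * ⟦ a x + ∑ a xs ⟧              ≡⟨ cong (q *_) (⟦⟧-+ (a x) (∑ a xs)) ⟩
  q * (⟦ a x ⟧ ℚ.+ ⟦ ∑ a xs ⟧)      ≡⟨ *-distribˡ-+ q _ _ ⟩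
  q * ⟦ a x ⟧ ℚ.+ q * ⟦ ∑ a xs ⟧    ≤⟨ +-mono-≤ (qa≤b x) (*-⟦∑⟧-mono q a b qa≤b xs) ⟩
  ⟦ b x ⟧ ℚ.+ ⟦ ∑ b xs ⟧            ≡⟨ sym (⟦⟧-+ (b x) (∑ b xs)) ⟩
  ⟦ b x + ∑ b xs ⟧                  ∎
  where open ≤-Reasoning

*-⟦⟧-≤-shrink-factor : ∀ q a b k k′ →
  q * ⟦ a ℕ.* k ⟧ ≤ℚ ⟦ b ℕ.* k ⟧ → k′ ≤ k → q * ⟦ a ℕ.* k′ ⟧ ≤ℚ ⟦ b ℕ.* k′ ⟧
*-⟦⟧-≤-shrink-factor q a b zero k′ _ z≤n rewrite ℕP.*-zeroʳ a = *⟦0⟧≤ q (b ℕ.* 0)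
*-⟦⟧-≤-shrink-factor q a b (suc t) k′ qak≤bk _ = begin
  q * ⟦ a ℕ.* k′ ⟧      ≡⟨ cong (q *_) (⟦⟧-* a k′) ⟩
  q * (⟦ a ⟧ * ⟦ k′ ⟧)  ≡⟨ sym (*-assoc q _ _) ⟩
  q * ⟦ a ⟧ * ⟦ k′ ⟧    ≤⟨ *-monoʳ-≤-nonNeg ⟦ k′ ⟧ {{⟦⟧-nonNeg k′}} qa≤b ⟩
  ⟦ b ⟧ * ⟦ k′ ⟧        ≡⟨ sym (⟦⟧-* b k′) ⟩
  ⟦ b ℕ.* k′ ⟧          ∎
  where
  open ≤-Reasoning
  qa≤b : q * ⟦ a ⟧ ≤ℚ ⟦ b ⟧
  qa≤b = *-cancelʳ-≤-pos ⟦ suc t ⟧ {{⟦⟧-pos t}} (begin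
    q * ⟦ a ⟧ * ⟦ suc t ⟧      ≡⟨ *-assoc q _ _ ⟩
    q * (⟦ a ⟧ * ⟦ suc t ⟧)    ≡⟨ cong (q *_) (sym (⟦⟧-* a (suc t))) ⟩
    q * ⟦ a ℕ.* suc t ⟧        ≤⟨ qak≤bk ⟩
    ⟦ b ℕ.* suc t ⟧            ≡⟨ ⟦⟧-* b (suc t) ⟩
    ⟦ b ⟧ * ⟦ suc t ⟧          ∎)

pow-+ : ∀ q a b → pow q (a + b) ≡ pow q a * pow q b
pow-+ q zero    b = sym (*-identityˡ _)
pow-+ q (suc a) b = trans (cong (q *_) (pow-+ q a b)) (sym (*-assoc q _ _))

pow-nonNeg : ∀ q → NonNegative q → ∀ k → NonNegative (pow q k)
pow-nonNeg q _     zero    = _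
pow-nonNeg q q≥0 (suc k) = nonNeg*nonNeg⇒nonNeg q {{q≥0}} (pow q k) {{pow-nonNeg q q≥0 k}}

2^[1+t]∸1 : ∀ t → 2 ^ suc t ∸ 1 ≡ (2 ^ t ∸ 1) + 2 ^ t
2^[1+t]∸1 t =
  trans (ℕP.+-∸-comm (2 ^ t + 0) (ℕP.m^n>0 2 t)) (cong (λ x → (2 ^ t ∸ 1) + x) (ℕP.+-identityʳ (2 ^ t)))

down-above : ∀ {n} m (σ : Subset n) cs s → m ≤ s → down m σ cs s ≡ σ
down-above zero    σ tt       s _   = refl
down-above (suc m) σ (c , cs) s 1+m≤s with suc m ≤ᵇ s | ℕP.≤⇒≤ᵇ 1+m≤s
... | true | _ = refl

down-step : ∀ {n} m (σ : Subset n) c cs s → s < suc m →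
            down (suc m) σ (c , cs) s ≡ down m (deleteNth (toℕ c) σ) cs s
down-step m σ c cs s s<1+m with suc m ≤ᵇ s | ℕP.≤ᵇ-reflects-≤ (suc m) s
... | false | _          = refl
... | true  | ofʸ 1+m≤s = ⊥-elim (ℕP.<⇒≱ s<1+m 1+m≤s)

deleteNth-size : ∀ {n} c (σ : Subset n) → c < ∣ σ ∣ → suc ∣ deleteNth c σ ∣ ≡ ∣ σ ∣
deleteNth-size c       (false ∷ σ) c<∣σ∣       = deleteNth-size c σ c<∣σ∣
deleteNth-size zero    (true ∷ σ)  _           = refl
deleteNth-size (suc c) (true ∷ σ)  (s≤s c<∣σ∣) = cong suc (deleteNth-size c σ c<∣σ∣)

down-size : ∀ {n} m (σ : Subset n) cs s → ∣ σ ∣ ≡ m → s ≤ m → ∣ down m σ cs s ∣ ≡ s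
down-size zero    σ tt       .zero ∣σ∣≡0 z≤n = ∣σ∣≡0
down-size (suc m) σ (c , cs) s     ∣σ∣≡1+m s≤1+m with ℕP.m≤n⇒m<n∨m≡n s≤1+m
... | inj₂ refl = trans (cong ∣_∣ (down-above (suc m) σ (c , cs) s ℕP.≤-refl)) ∣σ∣≡1+m
... | inj₁ s<1+m = trans (cong ∣_∣ (down-step m σ c cs s s<1+m))
  (down-size m (deleteNth (toℕ c) σ) cs s
    (ℕP.suc-injective (trans (deleteNth-size (toℕ c) σ c<∣σ∣) ∣σ∣≡1+m))
    (ℕP.≤-pred s<1+m))
  where
  c<∣σ∣ = subst (toℕ c <_) (sym ∣σ∣≡1+m) (toℕ<n c)

down-deleteNth : ∀ {n} m (σ : Subset n) cs s → s < m →
                 Σ ℕ λ c → down m σ cs s ≡ deleteNth c (down m σ cs (suc s))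
down-deleteNth (suc m) σ (c , cs) s (s≤s s≤m) with ℕP.m≤n⇒m<n∨m≡n s≤m
... | inj₂ refl
  rewrite down-step s σ c cs s (s≤s s≤m) | down-above (suc s) σ (c , cs) (suc s) ℕP.≤-refl
  = toℕ c , down-above s (deleteNth (toℕ c) σ) cs s ℕP.≤-refl
... | inj₁ s<m
  rewrite down-step m σ c cs s (s≤s s≤m) | down-step m σ c cs (suc s) (s≤s s<m)
  = down-deleteNth m (deleteNth (toℕ c) σ) cs s s<m

deleteNth-⊆ᵇ : ∀ {n} c (σ : Subset n) → T (deleteNth c σ ⊆ᵇ σ)
deleteNth-⊆ᵇ c       []          = tt
deleteNth-⊆ᵇ c       (false ∷ σ) = deleteNth-⊆ᵇ c σ
deleteNth-⊆ᵇ zero    (true ∷ σ)  = ⊆ᵇ-refl σ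
deleteNth-⊆ᵇ (suc c) (true ∷ σ)  = deleteNth-⊆ᵇ c σ

down-⊆ᵇ : ∀ {n} m (σ : Subset n) cs s → T (down m σ cs s ⊆ᵇ σ)
down-⊆ᵇ zero    σ tt       s = ⊆ᵇ-refl σ
down-⊆ᵇ (suc m) σ (c , cs) s with suc m ≤ᵇ s
... | true  = ⊆ᵇ-refl σ
... | false = ⊆ᵇ-trans (down m σ′ cs s) σ′ σ (down-⊆ᵇ m σ′ cs s) (deleteNth-⊆ᵇ (toℕ c) σ)
  where σ′ = deleteNth (toℕ c) σ

module _ {n} (X : Subset n → Bool) (d : ℕ) where

  outcomes-at-top-faces : All (λ o → T (X (proj₁ o)) × ∣ proj₁ o ∣ ≡ suc d) (outcomes X d)
  outcomes-at-top-faces = concat⁺ (map⁺ (All.map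
    (λ F-top → map⁺ (All.universal (λ _ → top F-top) (allChoices (suc d))))
    (all-filter _ (allSubsets n))))
    where
    top : ∀ {F} → (X F ∧ (∣ F ∣ ≡ᵇ suc d)) ≡ true → T (X F) × ∣ F ∣ ≡ suc d
    top {F} F-top with to (T-∧ {X F}) (from T-≡ F-top)
    ... | F∈X , ∣F∣≡ᵇ1+d = F∈X , ℕP.≡ᵇ⇒≡ ∣ F ∣ (suc d) ∣F∣≡ᵇ1+d

  W⇒Γ-above : IsSimplicialComplex X → ∀ {i} → i < d → (W : Subset n → Bool) →
    ∀ o → T (X (proj₁ o)) × ∣ proj₁ o ∣ ≡ suc d →
    T (W (Pat o (suc i))) → T (Γ X i W (Pat o (suc (suc i))))
  W⇒Γ-above closed {i} i<d W (F , cs) (F∈X , ∣F∣≡1+d) σ∈W =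
    from T-∧ (τ∈X , from T-∧ (ℕP.≡⇒≡ᵇ ∣ τ ∣ (suc (suc i)) (∣down∣ (suc (suc i)) (s≤s i<d)) ,
      any⁺ _ (lose (∈-allSubsets σ) (from T-∧ (σ∈W , from T-∧ (σ⊆τ , σ≢τ))))))
    where
    σ = down (suc d) F cs (suc i)
    τ = down (suc d) F cs (suc (suc i))
    ∣down∣ : ∀ s → s ≤ suc d → ∣ down (suc d) F cs s ∣ ≡ s
    ∣down∣ s = down-size (suc d) F cs s ∣F∣≡1+d
    τ∈X : T (X τ)
    τ∈X = closed τ F (down-⊆ᵇ (suc d) F cs (suc (suc i))) F∈X
    σ⊆τ : T (σ ⊆ᵇ τ)
    σ⊆τ with down-deleteNth (suc d) F cs (suc i) (s≤s i<d)
    ... | c , σ≡τ-c = subst (λ ρ → T (ρ ⊆ᵇ τ)) (sym σ≡τ-c) (deleteNth-⊆ᵇ c τ)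
    σ≢τ : T (not (σ ==ˢ τ))
    σ≢τ with σ ==ˢ τ in σ≟τ
    ... | false = _
    ... | true  = ⊥-elim (ℕP.1+n≢n (sym (begin
      suc i  ≡⟨ ∣down∣ (suc i) (ℕP.<⇒≤ (s≤s i<d)) ⟨
      ∣ σ ∣  ≡⟨ cong ∣_∣ (==ˢ-sound {σ = σ} {τ} (subst T (sym σ≟τ) _)) ⟩
      ∣ τ ∣  ≡⟨ ∣down∣ (suc (suc i)) (s≤s i<d) ⟩
      suc (suc i) ∎)))
      where open ≡-Reasoning

module _ {n : ℕ} where

  stepsInto : ℕ → Subset n → (Subset n → Bool) → ℕ
  stepsInto s τ l = count (λ cs → l (down s τ cs (s ∸ 1))) (allChoices s)

  -- Given that the walk is at τ at size s, its face at size s′ ≥ s and its next face are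
  -- independent: the count factorises, the second factor depending on τ and l only.
  record Markov {A : Set} (xs : List A) (walk : A → ℕ → Subset n) (s s′ : ℕ) (τ : Subset n)
                (u : Subset n → Bool) : Set where
    constructor factorisation
    field
      weight     : ℕ
      factorises : ∀ l → count (λ x → ((walk x s ==ˢ τ) ∧ u (walk x s′)) ∧ l (walk x (s ∸ 1))) xs
                         ≡ weight ℕ.* stepsInto s τ l
  open Markov

  Markov-concatMap : {A B : Set} (f : A → List B) (xs : List A)
                     {walk : B → ℕ → Subset n} {s s′ : ℕ} {τ : Subset n} {u : Subset n → Bool} →
                     (∀ x → Markov (f x) walk s s′ τ u) → Markov (concatMap f xs) walk s s′ τ u
  Markov-concatMap f xs M = factorisation (∑ (weight ∘ M) xs) λ l →
    trans (count-concatMap _ f xs) (trans (∑-cong xs (λ x → factorises (M x) l)) (∑-*ʳ (weight ∘ M) _ xs))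

  Markov-map : {A B : Set} (g : A → B) (xs : List A)
               {walk : B → ℕ → Subset n} {s s′ : ℕ} {τ : Subset n} {u : Subset n → Bool} →
               Markov xs (walk ∘ g) s s′ τ u → Markov (map g xs) walk s s′ τ u
  Markov-map g xs (factorisation N factorises) =
    factorisation N λ l → trans (count-map _ g xs) (factorises l)

  down-Markov-top : ∀ s σ s′ τ u → s ≤ s′ → Markov (allChoices s) (down s σ) s s′ τ u
  down-Markov-top s σ s′ τ u s≤s′ = factorisation (indicator ((σ ==ˢ τ) ∧ u σ)) λ l →
    trans (count-cong (allChoices s) (λ cs →
             cong₂ (λ ρ ρ′ → ((ρ ==ˢ τ) ∧ u ρ′) ∧ l (down s σ cs (s ∸ 1)))
                   (down-above s σ cs s ℕP.≤-refl) (down-above s σ cs s′ s≤s′)))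
          (by-cases l)
    where
    by-cases : ∀ l → count (λ cs → ((σ ==ˢ τ) ∧ u σ) ∧ l (down s σ cs (s ∸ 1))) (allChoices s)
                     ≡ indicator ((σ ==ˢ τ) ∧ u σ) ℕ.* stepsInto s τ l
    by-cases l with σ ==ˢ τ in σ≟τ
    ... | false = count-≡0 _ (allChoices s) (λ _ → refl)
    ... | true with ==ˢ-sound {σ = σ} {τ} (subst T (sym σ≟τ) _)
    ... | refl with u σ
    ... | true  = sym (ℕP.+-identityʳ _)
    ... | false = count-≡0 _ (allChoices s) (λ _ → refl)

  down-Markov : ∀ m σ s s′ τ u → s ≤ m → s ≤ s′ → Markov (allChoices m) (down m σ) s s′ τ u
  down-Markov m σ s s′ τ u s≤m s≤s′ with ℕP.m≤n⇒m<n∨m≡n s≤m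
  ... | inj₂ refl = down-Markov-top s σ s′ τ u s≤s′
  down-Markov (suc k) σ s s′ τ u _ s≤s′ | inj₁ (s≤s s≤k) =
    Markov-concatMap (λ c → map (c ,_) (allChoices k)) (List.allFin (suc k))
      (λ c → Markov-map (c ,_) (allChoices k) (first-step c))
    where
    -- u′ (down k (deleteNth (toℕ c) σ) cs s′) is definitionally u (down (suc k) σ (c , cs) s′),
    -- also when s′ ≥ suc k.
    u′ : Subset n → Bool
    u′ ρ = u (if suc k ≤ᵇ s′ then σ else ρ)
    first-step : ∀ c → Markov (allChoices k) (down (suc k) σ ∘ (c ,_)) s s′ τ u
    first-step c with down-Markov k (deleteNth (toℕ c) σ) s s′ τ u′ s≤k s≤s′
    ... | factorisation N factorises = factorisation N λ l →
      trans (count-cong (allChoices k) (λ cs →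
            cong₂ (λ ρ ρ′ → ((ρ ==ˢ τ) ∧ u′ (down k (deleteNth (toℕ c) σ) cs s′)) ∧ l ρ′)
                  (down-step k σ c cs s (s≤s s≤k))
                  (down-step k σ c cs (s ∸ 1) (s≤s (ℕP.≤-trans (ℕP.m∸n≤m s 1) s≤k)))))
          (factorises l)

  module _ (X : Subset n → Bool) (d : ℕ) where

    # : (Outcome n d → Bool) → ℕ
    # E = count E (outcomes X d)

    Pat-Markov : ∀ s s′ τ u → s ≤ suc d → s ≤ s′ → Markov (outcomes X d) Pat s s′ τ u
    Pat-Markov s s′ τ u s≤1+d s≤s′ = Markov-concatMap _ (facesOfSize X (suc d)) λ F →
      Markov-map (F ,_) (allChoices (suc d)) (down-Markov (suc d) F s s′ τ u s≤1+d s≤s′)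

    #-at-face : ∀ s τ (h : Subset n → Outcome n d → Bool) →
                # (λ o → (Pat o s ==ˢ τ) ∧ h (Pat o s) o) ≡ # (λ o → (Pat o s ==ˢ τ) ∧ h τ o)
    #-at-face s τ h = count-cong (outcomes X d) λ o → ==ˢ-∧-subst (Pat o s) τ (λ ρ → h ρ o)

    conditional-bound-at : ∀ s s′ τ (u : Subset n → Bool) q → s ≤ suc d → s ≤ s′ →
      q * ⟦ # (λ o → Pat o s ==ˢ τ) ⟧ ≤ℚ ⟦ # (λ o → (Pat o s ==ˢ τ) ∧ u (Pat o s′)) ⟧ →
      ∀ l → q * ⟦ # (λ o → (Pat o s ==ˢ τ) ∧ l (Pat o (s ∸ 1))) ⟧
            ≤ℚ ⟦ # (λ o → ((Pat o s ==ˢ τ) ∧ u (Pat o s′)) ∧ l (Pat o (s ∸ 1))) ⟧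
    conditional-bound-at s s′ τ u q s≤1+d s≤s′ bound l =
      subst₂ (λ a b → q * ⟦ a ⟧ ≤ℚ ⟦ b ⟧) (sym (#τ∧ l)) (sym (factorises Mᵤ l))
        (*-⟦⟧-≤-shrink-factor q (weight M₁) (weight Mᵤ) (steps (λ _ → true)) (steps l)
          (subst₂ (λ a b → q * ⟦ a ⟧ ≤ℚ ⟦ b ⟧)
            (trans (count-cong (outcomes X d) (λ o → sym (∧-identityʳ _))) (#τ∧ (λ _ → true)))
            (trans (count-cong (outcomes X d) (λ o → sym (∧-identityʳ _)))
                   (factorises Mᵤ (λ _ → true)))
            bound)
          (count-mono _ _ (allChoices s) (All.universal (λ _ _ → _) (allChoices s))))
      where
      steps = stepsInto s τ
      M₁ = Pat-Markov s s′ τ (λ _ → true) s≤1+d s≤s′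
      Mᵤ = Pat-Markov s s′ τ u s≤1+d s≤s′
      #τ∧ : ∀ l → # (λ o → (Pat o s ==ˢ τ) ∧ l (Pat o (s ∸ 1))) ≡ weight M₁ ℕ.* steps l
      #τ∧ l = trans (count-cong (outcomes X d) λ o →
                       cong (_∧ l (Pat o (s ∸ 1))) (sym (∧-identityʳ _)))
                    (factorises M₁ l)

    conditional-bound : ∀ s s′ (f u l : Subset n → Bool) q → s ≤ suc d → s ≤ s′ →
      (∀ τ → T (f τ) →
        q * ⟦ # (λ o → Pat o s ==ˢ τ) ⟧ ≤ℚ ⟦ # (λ o → (Pat o s ==ˢ τ) ∧ u (Pat o s′)) ⟧) →
      q * ⟦ # (λ o → f (Pat o s) ∧ l (Pat o (s ∸ 1))) ⟧
        ≤ℚ ⟦ # (λ o → (f (Pat o s) ∧ u (Pat o s′)) ∧ l (Pat o (s ∸ 1))) ⟧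
    conditional-bound s s′ f u l q s≤1+d s≤s′ bound =
      subst₂ (λ a b → q * ⟦ a ⟧ ≤ℚ ⟦ b ⟧)
        (sym (count-partition (λ o → Pat o s) _ (outcomes X d)))
        (sym (count-partition (λ o → Pat o s) _ (outcomes X d)))
        (*-⟦∑⟧-mono q _ _ at (allSubsets n))
      where
      at : ∀ τ → q * ⟦ # (λ o → (Pat o s ==ˢ τ) ∧ (f (Pat o s) ∧ l (Pat o (s ∸ 1)))) ⟧
                 ≤ℚ ⟦ # (λ o → (Pat o s ==ˢ τ) ∧ ((f (Pat o s) ∧ u (Pat o s′)) ∧ l (Pat o (s ∸ 1)))) ⟧
      at τ rewrite #-at-face s τ (λ ρ o → f ρ ∧ l (Pat o (s ∸ 1)))
                 | #-at-face s τ (λ ρ o → (f ρ ∧ u (Pat o s′)) ∧ l (Pat o (s ∸ 1)))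
                 with f τ in fτ
      ... | false =
        ≤-trans (≤-reflexive (cong (λ a → q * ⟦ a ⟧) (count-≡0 _ (outcomes X d) λ o → ∧-zeroʳ _)))
                (*⟦0⟧≤ q _)
      ... | true  =
        subst (λ b → q * ⟦ # (λ o → (Pat o s ==ˢ τ) ∧ l (Pat o (s ∸ 1))) ⟧ ≤ℚ ⟦ b ⟧)
              (count-cong (outcomes X d) λ o → ∧-assoc (Pat o s ==ˢ τ) (u (Pat o s′)) (l (Pat o (s ∸ 1))))
              (conditional-bound-at s s′ τ u q s≤1+d s≤s′ (bound τ (subst T (sym fτ) _)) l)

module _ {n} (X : Subset n → Bool) (d i : ℕ) (η : ℚ) (η≥0 : NonNegative η)
         (W : Subset n → Bool) (i≤d : i ≤ d) where

  fatSet-suc⇒link-bound : ∀ t s → s + suc t ≡ suc i → ∀ σ → T (fatSet X d i η W (suc t) σ) →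
    pow η (2 ^ t) * ⟦ # X d (λ o → Pat o s ==ˢ σ) ⟧
      ≤ℚ ⟦ # X d (λ o → (Pat o s ==ˢ σ) ∧ fatSet X d i η W t (Pat o (suc s))) ⟧
  fatSet-suc⇒link-bound t s s+1+t≡1+i σ σ-fat =
    subst₂ (λ k k′ → pow η (2 ^ t) * ⟦ # X d (λ o → Pat o k ==ˢ σ) ⟧
                       ≤ℚ ⟦ # X d (λ o → (Pat o k ==ˢ σ) ∧ fatSet X d i η W t (Pat o k′)) ⟧)
      ∣σ∣≡s 1+i∸t≡1+s
      (≤-ratio⇒*-≤ (pow η (2 ^ t)) _ _ (≤ᵇ⇒≤ (proj₂ size-and-link)))
    where
    size-and-link = to (T-∧ {∣ σ ∣ ≡ᵇ suc i ∸ suc t}) (proj₂ (to (T-∧ {X σ}) σ-fat))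
    ∣σ∣≡s : ∣ σ ∣ ≡ s
    ∣σ∣≡s = trans (ℕP.≡ᵇ⇒≡ ∣ σ ∣ (suc i ∸ suc t) (proj₁ size-and-link))
                  (trans (cong (_∸ suc t) (sym s+1+t≡1+i)) (ℕP.m+n∸n≡m s (suc t)))
    1+i∸t≡1+s : suc i ∸ t ≡ suc s
    1+i∸t≡1+s = trans (cong (_∸ t) (trans (sym s+1+t≡1+i) (ℕP.+-suc s t))) (ℕP.m+n∸n≡m (suc s) t)

  fatSet⇒W-bound : ∀ t s → s + t ≡ suc i → ∀ σ → T (fatSet X d i η W t σ) →
    pow η (2 ^ t ∸ 1) * ⟦ # X d (λ o → Pat o s ==ˢ σ) ⟧
      ≤ℚ ⟦ # X d (λ o → (Pat o s ==ˢ σ) ∧ W (Pat o (suc i))) ⟧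
  fatSet⇒W-bound zero s s+0≡1+i σ σ∈W with trans (sym (ℕP.+-identityʳ s)) s+0≡1+i
  ... | refl = ≤-reflexive (trans (*-identityˡ _) (cong ⟦_⟧ (count-cong (outcomes X d) λ o → begin
    Pat o s ==ˢ σ                    ≡⟨ ∧-identityʳ _ ⟨
    (Pat o s ==ˢ σ) ∧ true           ≡⟨ cong (_ ∧_) (to T-≡ σ∈W) ⟨
    (Pat o s ==ˢ σ) ∧ W σ            ≡⟨ ==ˢ-∧-subst (Pat o s) σ W ⟨
    (Pat o s ==ˢ σ) ∧ W (Pat o s)    ∎)))
    where open ≡-Reasoning
  fatSet⇒W-bound (suc t) s s+1+t≡1+i σ σ-fat = begin
    pow η (2 ^ suc t ∸ 1) * ⟦ # X d at-σ ⟧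
      ≡⟨ cong (λ e → pow η e * ⟦ # X d at-σ ⟧) (2^[1+t]∸1 t) ⟩
    pow η ((2 ^ t ∸ 1) + 2 ^ t) * ⟦ # X d at-σ ⟧
      ≡⟨ cong (_* ⟦ # X d at-σ ⟧) (pow-+ η (2 ^ t ∸ 1) (2 ^ t)) ⟩
    a * pow η (2 ^ t) * ⟦ # X d at-σ ⟧
      ≡⟨ *-assoc a (pow η (2 ^ t)) ⟦ # X d at-σ ⟧ ⟩
    a * (pow η (2 ^ t) * ⟦ # X d at-σ ⟧)
      ≤⟨ *-monoˡ-≤-nonNeg a {{pow-nonNeg η η≥0 (2 ^ t ∸ 1)}}
           (fatSet-suc⇒link-bound t s s+1+t≡1+i σ σ-fat) ⟩
    a * ⟦ # X d (λ o → at-σ o ∧ fat (Pat o (suc s))) ⟧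
      ≡⟨ cong (λ k → a * ⟦ k ⟧) (count-cong (outcomes X d) (λ o → ∧-comm (at-σ o) _)) ⟩
    a * ⟦ # X d (λ o → fat (Pat o (suc s)) ∧ at-σ o) ⟧
      ≤⟨ conditional-bound X d (suc s) (suc i) fat W (_==ˢ σ) a
           (ℕP.≤-trans 1+s≤1+i (s≤s i≤d)) 1+s≤1+i (fatSet⇒W-bound t (suc s) 1+s+t≡1+i) ⟩
    ⟦ # X d (λ o → (fat (Pat o (suc s)) ∧ W (Pat o (suc i))) ∧ at-σ o) ⟧
      ≤⟨ ⟦⟧-mono (count-mono _ _ (outcomes X d)
           (All.universal (λ o → drop-fat (fat (Pat o (suc s))) _ _) _)) ⟩
    ⟦ # X d (λ o → at-σ o ∧ W (Pat o (suc i))) ⟧ ∎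
    where
    open ≤-Reasoning
    a = pow η (2 ^ t ∸ 1)
    fat = fatSet X d i η W t
    at-σ : Outcome n d → Bool
    at-σ o = Pat o s ==ˢ σ
    1+s+t≡1+i : suc s + t ≡ suc i
    1+s+t≡1+i = trans (sym (ℕP.+-suc s t)) s+1+t≡1+i
    1+s≤1+i : suc s ≤ suc i
    1+s≤1+i = subst (suc s ≤_) 1+s+t≡1+i (ℕP.m≤m+n (suc s) t)
    drop-fat : ∀ x w y → T ((x ∧ w) ∧ y) → T (y ∧ w)
    drop-fat true true true _ = _

proposition2p7 : (n d : ℕ) (X : Subset n → Bool) →
    IsSimplicialComplex X → IsPureOfDim X d →
    (i : ℕ) → i < d →
    (η : ℚ) → 0ℚ <ℚ η → η <ℚ 1ℚ →
    (W : Subset n → Bool) → ((σ : Subset n) → T (W σ) → T (X σ) × ∣ σ ∣ ≡ suc i) →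
    (j : ℕ) → j ≤ i →
    (pow η (2 ^ (i ∸ j) ∸ 1) *
       Pr X d (λ o → S X d i η W (suc j) (Pat o (suc j)) ∧ not (S X d i η W j (Pat o j))))
    ≤ℚ
    Pr X d (λ o → Γ X i W (Pat o (suc (suc i))) ∧ not (S X d i η W j (Pat o j)))
proposition2p7 n d X closed _ i i<d η 0<η _ W _ j j≤i =
  *-ratio-mono q _ _ (length (outcomes X d)) (begin
    q * ⟦ # X d (λ o → Sʲ (Pat o (suc j)) ∧ below o) ⟧
      ≤⟨ conditional-bound X d (suc j) (suc i) Sʲ W (not ∘ Sʲ⁻¹) q
           (s≤s (ℕP.≤-trans j≤i (ℕP.<⇒≤ i<d))) (s≤s j≤i)
           (fatSet⇒W-bound X d i η η≥0 W (ℕP.<⇒≤ i<d) (i ∸ j) (suc j)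
             (cong suc (ℕP.m+[n∸m]≡n j≤i))) ⟩
    ⟦ # X d (λ o → (Sʲ (Pat o (suc j)) ∧ W (Pat o (suc i))) ∧ below o) ⟧
      ≤⟨ ⟦⟧-mono (count-mono _ _ (outcomes X d)
           (All.map (λ {o} → reaches-Γ o) (outcomes-at-top-faces X d))) ⟩
    ⟦ # X d (λ o → Γ X i W (Pat o (suc (suc i))) ∧ below o) ⟧ ∎)
  where
  open ≤-Reasoning
  q = pow η (2 ^ (i ∸ j) ∸ 1)
  η≥0 = pos⇒nonNeg η {{ℚ.positive 0<η}}
  Sʲ = S X d i η W (suc j)
  Sʲ⁻¹ = S X d i η W j
  below : Outcome n d → Bool
  below o = not (Sʲ⁻¹ (Pat o j))
  reaches-Γ : ∀ o → T (X (proj₁ o)) × ∣ proj₁ o ∣ ≡ suc d →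
    T ((Sʲ (Pat o (suc j)) ∧ W (Pat o (suc i))) ∧ below o) →
    T (Γ X i W (Pat o (suc (suc i))) ∧ below o)
  reaches-Γ o top h with to (T-∧ {Sʲ (Pat o (suc j)) ∧ W (Pat o (suc i))}) h
  ... | S∧W , b = from T-∧ (W⇒Γ-above X d closed i<d W o top (proj₂ (to (T-∧ {Sʲ (Pat o (suc j))}) S∧W)) , b)
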